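{- Let $Z$ be a non-degenerate multimatroid and let $\prec$ be a total ordering of its skew classes. Then for every basis $B$ of $Z$, \[ |[B]| = \prod_{\omega\in \mathrm{act}_{\prec}(B)}(|\omega|-1),\] where $[B]$ is the equivalence class of $B$ under $\sim$.
   Context: A carrier is a pair $(U,\Omega)$, $U$ finite, $\Omega$ a partition of $U$ into non-empty skew classes; subtransversals meet each skew class at most once, transversals exactly once; a skew pair is two distinct elements of a skew class. A multimatroid $Z=(U,\Omega,r)$ has a non-negative integer $r$ on subtransversals with (R1) on each transversal, $r$ is a matroid rank function; (R2) for subtransversal $S$ and skew pair $\{x,y\}$ in a skew class disjoint from $S$, $r(S\cup\{x\})+r(S\cup\{y\})-2r(S)\ge1$. Bases are maximal subtransversals $S$ with $r(S)=|S|$; circuits are minimal subtransversals with $r(S)<|S|$. Non-degenerate: each skew class has size $\ge2$ (so bases are transversals). $S_\omega$ is the element of $S\cap\omega$. For basis $B$ and skew class $\omega$, $B\cup\omega$ contains at most one circuit $C(B,\omega)$; $\underline B_\omega$ is the element of $C(B,\omega)-B$. $\prec$ induces an order on any subtransversal with least element $\min$. $\omega$ is active w.r.t. $B$ if $C(B,\omega)$ exists and $\min C(B,\omega)\in\omega$, inactive otherwise; $\mathrm{act}_\prec(B)$, $\mathrm{inact}_\prec(B)$ denote these sets. Bases $B,B'$ satisfy $B\sim B'$ if $\mathrm{act}_\prec(B)=\mathrm{act}_\prec(B')$ and $B_\omega=B'_\omega$ for all $\omega\in\mathrm{inact}_\prec(B)$. -}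

module Defs where

open import Data.Nat using (ℕ; _≤_; _<_; _+_; _*_; _∸_)
open import Data.Fin using (Fin)
open import Data.Fin.Properties using (_≟_)
open import Data.Fin.Subset using (Subset; _∈_; _⊆_; _⊂_; _∪_; _∩_; ∣_∣; ⁅_⁆)
open import Data.List using (List; length; filter; map; allFin)
open import Data.Nat.ListAction using (product)
open import Data.List.Relation.Unary.Unique.Propositional using (Unique)
import Data.List.Membership.Propositional as LM
open import Data.Product using (Σ; ∃; ∃₂; _×_; _,_)
open import Data.Sum using (_⊎_)
open import Relation.Binary.PropositionalEquality using (_≡_; _≢_)
open import Relation.Binary.Core using (Rel)
open import Relation.Binary.Structures using (IsStrictTotalOrder)
open import Relation.Nullary using (¬_)
open import Function.Bundles using (_⇔_)
open import Level using (0ℓ)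

-- A carrier: U = Fin m, skew classes indexed by Fin n, cls x = skew class of x.
-- Subsets of U are Data.Fin.Subset m.
module _ {m n : ℕ} (cls : Fin m → Fin n) where

  IsSubtransversal : Subset m → Set
  IsSubtransversal S = ∀ x y → x ∈ S → y ∈ S → cls x ≡ cls y → x ≡ y

  IsTransversal : Subset m → Set
  IsTransversal S = IsSubtransversal S × (∀ ω → ∃ λ x → x ∈ S × cls x ≡ ω)

  classSize : Fin n → ℕ
  classSize ω = length (filter (λ x → cls x ≟ ω) (allFin m))

IsMatroidRankOn : {m : ℕ} → (Subset m → ℕ) → Subset m → Set
IsMatroidRankOn r T =
  (∀ X → X ⊆ T → r X ≤ ∣ X ∣) ×
  (∀ X Y → X ⊆ T → Y ⊆ T → X ⊆ Y → r X ≤ r Y) ×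
  (∀ X Y → X ⊆ T → Y ⊆ T → r (X ∪ Y) + r (X ∩ Y) ≤ r X + r Y)

record Multimatroid (m n : ℕ) : Set where
  field
    cls  : Fin m → Fin n
    cls-surj : ∀ ω → ∃ λ x → cls x ≡ ω
    -- rank (only its values on subtransversals matter)
    r    : Subset m → ℕ
    R1   : ∀ T → IsTransversal cls T → IsMatroidRankOn r T
    R2   : ∀ S x y → IsSubtransversal cls S → x ≢ y → cls x ≡ cls y →
           (∀ z → z ∈ S → cls z ≢ cls x) →
           2 * r S + 1 ≤ r (S ∪ ⁅ x ⁆) + r (S ∪ ⁅ y ⁆)

module _ {m n : ℕ} (Z : Multimatroid m n) where
  open Multimatroid Z

  NonDegenerate : Set
  NonDegenerate = ∀ ω → ∃₂ λ x y → x ≢ y × cls x ≡ ω × cls y ≡ ω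

  IsIndependent : Subset m → Set
  IsIndependent S = IsSubtransversal cls S × r S ≡ ∣ S ∣

  IsBasis : Subset m → Set
  IsBasis S = IsIndependent S × (∀ S' → S ⊂ S' → ¬ IsIndependent S')

  IsDependent : Subset m → Set
  IsDependent S = IsSubtransversal cls S × r S < ∣ S ∣

  IsCircuit : Subset m → Set
  IsCircuit C = IsDependent C × (∀ C' → C' ⊂ C → ¬ IsDependent C')

  module _ (_≺_ : Rel (Fin n) 0ℓ) where

    MinIn : Subset m → Fin n → Set
    MinIn C ω = (∃ λ x → x ∈ C × cls x ≡ ω) × (∀ y → y ∈ C → cls y ≡ ω ⊎ ω ≺ cls y)

    -- ω is active w.r.t. B: the (unique) circuit C(B,ω) ⊆ B ∪ ω exists
    -- and its minimum lies in ω
    Active : Subset m → Fin n → Set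
    Active B ω = ∃ λ C → IsCircuit C × (∀ x → x ∈ C → x ∈ B ⊎ cls x ≡ ω) × MinIn C ω

    Inactive : Subset m → Fin n → Set
    Inactive B ω = ¬ Active B ω

    SameAt : Subset m → Subset m → Fin n → Set
    SameAt B B' ω = ∀ x → cls x ≡ ω → (x ∈ B ⇔ x ∈ B')

    _∼_ : Subset m → Subset m → Set
    B ∼ B' = (∀ ω → Active B ω ⇔ Active B' ω) × (∀ ω → Inactive B ω → SameAt B B' ω)

    Enumerates : {A : Set} → List A → (A → Set) → Set
    Enumerates L P = Unique L × (∀ a → (a LM.∈ L) ⇔ P a)

    ClassCountFormula : Subset m → Set
    ClassCountFormula B =
      Σ (List (Fin n)) λ A → Enumerates A (Active B) ×
      Σ (List (Subset m)) λ L → Enumerates L (λ B' → IsBasis B' × B ∼ B') ×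
      length L ≡ product (map (λ ω → classSize cls ω ∸ 1) A)

{-# OPTIONS --safe #-}
module Submission where

-- Encode a basis B by the section f of the class map whose image is B, and call y ∈ ω spanned above ω
-- when y together with the elements of B in classes ≻ ω is dependent. A class ω is active exactly when
-- such a y exists, and then y is unique: it is B̲_ω. Axiom (R2) gives an exchange property: replacing
-- B_ω by any element of ω other than the spanned one keeps B independent and does not change which
-- elements are spanned above any class. Iterating this, every transversal that agrees with B on the
-- inactive classes and avoids B̲_ω on the active ones is a basis equivalent to B. Conversely, downward
-- induction along ≺ shows that every basis equivalent to B has this form. So [B] is in bijection with
-- the product of the sets ω − {B̲_ω}, taken over the active ω.

open import Defs
open import Level using (0ℓ)
open import Function using (_∘_; id; flip)
open import Function.Bundles using (_⇔_; mk⇔; Equivalence)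
open import Function.Construct.Composition using (_⇔-∘_)
open import Function.Construct.Symmetry using (⇔-sym)
open import Induction.WellFounded using (Acc; acc)
open import Data.Empty using (⊥-elim)
open import Data.Unit using (tt)
open import Data.Product using (∃; _×_; _,_; proj₁; proj₂)
open import Data.Sum using (_⊎_; inj₁; inj₂)
open import Data.Nat using (ℕ; zero; suc; _≤_; _<_; _+_; _*_; _∸_; _<?_)
open import Data.Nat.Properties
  using (+-suc; +-comm; +-identityʳ; ≤-antisym; ≤-pred; ≤∧≢⇒<; <⇒≢; m≤m+n; +-monoʳ-≤; +-cancelʳ-≤;
         module ≤-Reasoning)
open import Data.Nat.Induction using (<-wellFounded)
open import Data.Nat.ListAction using (product)
open import Data.Fin using (Fin; zero; suc)
open import Data.Fin.Properties using (_≟_; any?)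
open import Data.Fin.Induction using (spo-noetherian)
open import Data.Fin.Subset using (Subset; inside; outside; _∈_; _∉_; _⊆_; _⊂_; _∪_; _∩_; _─_; _-_; ∣_∣; ⁅_⁆)
open import Data.Fin.Subset.Properties
  using (_∈?_; ⊆-antisym; p⊆p∪q; q⊆p∪q; x∈p∪q⁻; x∈⁅x⁆; x∈⁅y⁆⇒x≡y; p─q⊆p; x∈p∧x∉q⇒x∈p─q; x∈p∧x≢y⇒x∈p-y;
         x∈p⇒∣p-x∣<∣p∣; ∪-identityʳ; ∪-assoc; ∪-comm)
open import Data.Vec using (Vec; []; _∷_; lookup; tabulate; here; there)
open import Data.Vec.Properties
  using (lookup⇒[]=; []=⇒lookup; lookup∘tabulate; tabulate∘lookup; tabulate-cong; ∷-injective)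
open import Data.Vec.Functional using (updateAt)
open import Data.Vec.Functional.Properties using (updateAt-updates; updateAt-minimal; updateAt-id-local)
open import Data.List using (List; []; _∷_; [_]; length; filter; map; allFin; cartesianProductWith)
import Data.List as List
open import Data.List.Properties
  using (length-++; length-map; map-tabulate; filter-accept; filter-reject; filter-all; filter-none; filter-≐)
open import Data.List.Membership.Propositional using () renaming (_∈_ to _∈ₗ_)
open import Data.List.Membership.Propositional.Properties using (∈-allFin; ∈-filter⁺; ∈-filter⁻; ∈-map⁺; ∈-map⁻)
open import Data.List.Relation.Unary.Any using () renaming (here to hereₗ; there to thereₗ)
import Data.List.Relation.Unary.Any.Properties as Any
open import Data.List.Relation.Unary.Any.Properties using (¬Any[])
open import Data.List.Relation.Unary.All using ([]; _∷_)
import Data.List.Relation.Unary.All as All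
import Data.List.Relation.Unary.All.Properties as All
open import Data.List.Relation.Unary.Unique.Propositional using (Unique; []; _∷_)
import Data.List.Relation.Unary.Unique.Propositional.Properties as Unique
open import Relation.Binary.Core using (Rel)
open import Relation.Binary.Definitions using (DecidableEquality)
open import Relation.Binary.Structures using (IsStrictTotalOrder)
open import Relation.Binary.PropositionalEquality
  using (_≡_; _≢_; refl; sym; trans; cong; cong₂; subst; module ≡-Reasoning)
open import Relation.Nullary using (¬_; Dec; yes; no; does; proof; ¬?; _×-dec_; _→-dec_)
open import Relation.Nullary.Decidable using (dec-true; decidable-stable)
open import Relation.Nullary.Reflects using (Reflects; invert)
open import Relation.Unary using (Pred; Decidable; _≐_)
open import Relation.Unary.Properties using (U?)

2*m+1≤n+o⇒o≤m⇒m<n : ∀ {m n o} → 2 * m + 1 ≤ n + o → o ≤ m → m < n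
2*m+1≤n+o⇒o≤m⇒m<n {m} {n} {o} 2m+1≤n+o o≤m = +-cancelʳ-≤ m (suc m) n (begin
  suc (m + m)  ≡⟨ cong (λ k → suc (m + k)) (sym (+-identityʳ m)) ⟩
  1 + 2 * m    ≡⟨ +-comm 1 (2 * m) ⟩
  2 * m + 1    ≤⟨ 2m+1≤n+o ⟩
  n + o        ≤⟨ +-monoʳ-≤ n o≤m ⟩
  n + m        ∎)
  where open ≤-Reasoning

∣p∪[q─p]∣≡∣p∣+∣q─p∣ : ∀ {k} (p q : Subset k) → ∣ p ∪ (q ─ p) ∣ ≡ ∣ p ∣ + ∣ q ─ p ∣
∣p∪[q─p]∣≡∣p∣+∣q─p∣ []            []            = refl
∣p∪[q─p]∣≡∣p∣+∣q─p∣ (inside  ∷ p) (_       ∷ q) = cong suc (∣p∪[q─p]∣≡∣p∣+∣q─p∣ p q)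
∣p∪[q─p]∣≡∣p∣+∣q─p∣ (outside ∷ p) (inside  ∷ q) =
  trans (cong suc (∣p∪[q─p]∣≡∣p∣+∣q─p∣ p q)) (sym (+-suc _ _))
∣p∪[q─p]∣≡∣p∣+∣q─p∣ (outside ∷ p) (outside ∷ q) = ∣p∪[q─p]∣≡∣p∣+∣q─p∣ p q

x∉p⇒∣p∪⁅x⁆∣≡1+∣p∣ : ∀ {k} (p : Subset k) {x : Fin k} → x ∉ p → ∣ p ∪ ⁅ x ⁆ ∣ ≡ suc ∣ p ∣
x∉p⇒∣p∪⁅x⁆∣≡1+∣p∣ (inside  ∷ p) {zero}  x∉p = ⊥-elim (x∉p here)
x∉p⇒∣p∪⁅x⁆∣≡1+∣p∣ (outside ∷ p) {zero}  x∉p = cong (suc ∘ ∣_∣) (∪-identityʳ p)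
x∉p⇒∣p∪⁅x⁆∣≡1+∣p∣ (inside  ∷ p) {suc x} x∉p = cong suc (x∉p⇒∣p∪⁅x⁆∣≡1+∣p∣ p (x∉p ∘ there))
x∉p⇒∣p∪⁅x⁆∣≡1+∣p∣ (outside ∷ p) {suc x} x∉p = x∉p⇒∣p∪⁅x⁆∣≡1+∣p∣ p (x∉p ∘ there)

module _ {k : ℕ} where

  p⊆q⇒p∪[q─p]≡q : {p q : Subset k} → p ⊆ q → p ∪ (q ─ p) ≡ q
  p⊆q⇒p∪[q─p]≡q {p} {q} p⊆q = ⊆-antisym ⊆q q⊆
    where
    ⊆q : p ∪ (q ─ p) ⊆ q
    ⊆q x∈ with x∈p∪q⁻ p (q ─ p) x∈
    ... | inj₁ x∈p   = p⊆q x∈p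
    ... | inj₂ x∈q─p = p─q⊆p q p x∈q─p
    q⊆ : q ⊆ p ∪ (q ─ p)
    q⊆ {x} x∈q with x ∈? p
    ... | yes x∈p = p⊆p∪q (q ─ p) x∈p
    ... | no  x∉p = q⊆p∪q p (q ─ p) (x∈p∧x∉q⇒x∈p─q x∈q x∉p)

  x∈p∪⁅x⁆ : {p : Subset k} (x : Fin k) → x ∈ p ∪ ⁅ x ⁆
  x∈p∪⁅x⁆ {p} x = q⊆p∪q p ⁅ x ⁆ (x∈⁅x⁆ x)

  x∈p∪⁅y⁆⁻ : {p : Subset k} {x y : Fin k} → x ∈ p ∪ ⁅ y ⁆ → x ∈ p ⊎ x ≡ y
  x∈p∪⁅y⁆⁻ {p} {y = y} x∈ with x∈p∪q⁻ p ⁅ y ⁆ x∈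
  ... | inj₁ x∈p = inj₁ x∈p
  ... | inj₂ x∈y = inj₂ (x∈⁅y⁆⇒x≡y y x∈y)

  p⊆q⇒p∪⁅x⁆⊆q∪⁅x⁆ : {p q : Subset k} {x : Fin k} → p ⊆ q → p ∪ ⁅ x ⁆ ⊆ q ∪ ⁅ x ⁆
  p⊆q⇒p∪⁅x⁆⊆q∪⁅x⁆ {x = x} p⊆q y∈ with x∈p∪⁅y⁆⁻ y∈
  ... | inj₁ y∈p  = p⊆p∪q ⁅ x ⁆ (p⊆q y∈p)
  ... | inj₂ refl = x∈p∪⁅x⁆ x

  [p∪q]∪r≡[p∪r]∪q : (p q r : Subset k) → (p ∪ q) ∪ r ≡ (p ∪ r) ∪ q
  [p∪q]∪r≡[p∪r]∪q p q r = begin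
    (p ∪ q) ∪ r  ≡⟨ ∪-assoc p q r ⟩
    p ∪ (q ∪ r)  ≡⟨ cong (p ∪_) (∪-comm q r) ⟩
    p ∪ (r ∪ q)  ≡⟨ sym (∪-assoc p r q) ⟩
    (p ∪ r) ∪ q  ∎
    where open ≡-Reasoning

  ⟦_⟧ : ∀ {ℓ} {P : Pred (Fin k) ℓ} → Decidable P → Subset k
  ⟦ P? ⟧ = tabulate (does ∘ P?)

  ∈⟦⟧⁺ : ∀ {ℓ} {P : Pred (Fin k) ℓ} (P? : Decidable P) {x : Fin k} → P x → x ∈ ⟦ P? ⟧
  ∈⟦⟧⁺ P? {x} px = lookup⇒[]= x _ (trans (lookup∘tabulate (does ∘ P?) x) (dec-true (P? x) px))

  ∈⟦⟧⁻ : ∀ {ℓ} {P : Pred (Fin k) ℓ} (P? : Decidable P) {x : Fin k} → x ∈ ⟦ P? ⟧ → P x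
  ∈⟦⟧⁻ {P = P} P? {x} x∈ =
    invert (subst (Reflects (P x)) (trans (sym (lookup∘tabulate (does ∘ P?) x)) ([]=⇒lookup x∈)) (proof (P? x)))

module _ {a} {A : Set a} where

  unique-map⁺ : ∀ {b} {B : Set b} {f : A → B} {xs : List A} →
                (∀ {x y} → x ∈ₗ xs → y ∈ₗ xs → f x ≡ f y → x ≡ y) → Unique xs → Unique (map f xs)
  unique-map⁺ {xs = []}     _   []         = []
  unique-map⁺ {xs = x ∷ xs} inj (x∉ ∷ xs!) =
    All.map⁺ (All.tabulate (λ y∈ fx≡fy → All.lookup x∉ y∈ (inj (hereₗ refl) (thereₗ y∈) fx≡fy)))
    ∷ unique-map⁺ (λ x∈ y∈ → inj (thereₗ x∈) (thereₗ y∈)) xs!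

  length-filter-≢ : (_≟ᴬ_ : DecidableEquality A) {xs : List A} {a : A} → Unique xs → a ∈ₗ xs →
                    length (filter (λ x → ¬? (x ≟ᴬ a)) xs) ≡ length xs ∸ 1
  length-filter-≢ _≟ᴬ_ {x ∷ xs} (x∉ ∷ _) (hereₗ refl) =
    trans (cong length (filter-reject (λ y → ¬? (y ≟ᴬ x)) (λ x≢x → x≢x refl)))
          (cong length (filter-all (λ y → ¬? (y ≟ᴬ x)) (All.map (λ x≢y y≡x → x≢y (sym y≡x)) x∉)))
  length-filter-≢ _≟ᴬ_ {x ∷ y ∷ xs} {a} (x∉ ∷ xs!) (thereₗ a∈) =
    trans (cong length (filter-accept (λ z → ¬? (z ≟ᴬ a)) (All.lookup x∉ a∈)))
          (cong suc (length-filter-≢ _≟ᴬ_ xs! a∈))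

  length-filter-≡ : (_≟ᴬ_ : DecidableEquality A) {xs : List A} {a : A} → Unique xs → a ∈ₗ xs →
                    length (filter (_≟ᴬ a) xs) ≡ 1
  length-filter-≡ _≟ᴬ_ {x ∷ xs} (x∉ ∷ _) (hereₗ refl) =
    trans (cong length (filter-accept (_≟ᴬ x) refl))
          (cong (suc ∘ length) (filter-none (_≟ᴬ x) (All.map (λ x≢y y≡x → x≢y (sym y≡x)) x∉)))
  length-filter-≡ _≟ᴬ_ {x ∷ xs} {a} (x∉ ∷ xs!) (thereₗ a∈) =
    trans (cong length (filter-reject (_≟ᴬ a) (All.lookup x∉ a∈))) (length-filter-≡ _≟ᴬ_ xs! a∈)

  product-map-filter : ∀ {p} {P : Pred A p} (P? : Decidable P) (g h : A → ℕ) (xs : List A) →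
                       (∀ x → P x → h x ≡ g x) → (∀ x → ¬ P x → h x ≡ 1) →
                       product (map h xs) ≡ product (map g (filter P? xs))
  product-map-filter P? g h []       on off = refl
  product-map-filter P? g h (x ∷ xs) on off with P? x
  ... | yes px = cong₂ _*_ (on x px) (product-map-filter P? g h xs on off)
  ... | no ¬px = trans (cong (_* product (map h xs)) (off x ¬px))
                       (trans (+-identityʳ _) (product-map-filter P? g h xs on off))

  length-cartesianProductWith : ∀ {b c} {B : Set b} {C : Set c} (f : A → B → C) (xs : List A) (ys : List B) →
                                length (cartesianProductWith f xs ys) ≡ length xs * length ys
  length-cartesianProductWith f []       ys = refl
  length-cartesianProductWith f (x ∷ xs) ys =
    trans (length-++ (map (f x) ys)) (cong₂ _+_ (length-map (f x) ys) (length-cartesianProductWith f xs ys))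

  choices : ∀ {k} → (Fin k → List A) → List (Vec A k)
  choices {zero}  C = [ [] ]
  choices {suc k} C = cartesianProductWith _∷_ (C zero) (choices (C ∘ suc))

  length-choices : ∀ {k} (C : Fin k → List A) → length (choices C) ≡ product (List.tabulate (length ∘ C))
  length-choices {zero}  C = refl
  length-choices {suc k} C =
    trans (length-cartesianProductWith _∷_ (C zero) (choices (C ∘ suc)))
          (cong (length (C zero) *_) (length-choices (C ∘ suc)))

  ∈-choices⁺ : ∀ {k} (C : Fin k → List A) (v : Vec A k) → (∀ i → lookup v i ∈ₗ C i) → v ∈ₗ choices C
  ∈-choices⁺ C []      _  = hereₗ refl
  ∈-choices⁺ C (a ∷ v) v∈ =
    Any.cartesianProductWith⁺ _∷_ (cong₂ _∷_) (v∈ zero) (∈-choices⁺ (C ∘ suc) v (v∈ ∘ suc))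

  ∈-choices⁻ : ∀ {k} (C : Fin k → List A) (v : Vec A k) → v ∈ₗ choices C → ∀ i → lookup v i ∈ₗ C i
  ∈-choices⁻ C (a ∷ v) v∈ i with Any.cartesianProductWith⁻ _∷_ ∷-injective (C zero) (choices (C ∘ suc)) v∈
  ∈-choices⁻ C (a ∷ v) _ zero    | a∈ , _  = a∈
  ∈-choices⁻ C (a ∷ v) _ (suc i) | _  , v∈ = ∈-choices⁻ (C ∘ suc) v v∈ i

  choices-unique : ∀ {k} (C : Fin k → List A) → (∀ i → Unique (C i)) → Unique (choices C)
  choices-unique {zero}  C _  = [] ∷ []
  choices-unique {suc k} C C! =
    Unique.cartesianProductWith⁺ _∷_ ∷-injective (C! zero) (choices-unique (C ∘ suc) (C! ∘ suc))

module _ {m n : ℕ} (Z : Multimatroid m n) where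
  open Multimatroid Z

  Subtransversal : Subset m → Set
  Subtransversal = IsSubtransversal cls

  Avoids : Subset m → Fin n → Set
  Avoids S ω = ∀ {z} → z ∈ S → cls z ≢ ω

  -- Only meaningful for subtransversals S: elsewhere r is unconstrained.
  Indep Dep : Subset m → Set
  Indep S = r S ≡ ∣ S ∣
  Dep   S = r S < ∣ S ∣

  IsSection : (Fin n → Fin m) → Set
  IsSection f = ∀ c → cls (f c) ≡ c

  -- When f is a section, f ↾ P? = { f c ∣ P c }.
  _↾_ : ∀ {ℓ} {P : Pred (Fin n) ℓ} → (Fin n → Fin m) → Decidable P → Subset m
  f ↾ P? = ⟦ (λ x → P? (cls x) ×-dec (f (cls x) ≟ x)) ⟧

  _∖?_ : ∀ {ℓ} {P : Pred (Fin n) ℓ} → Decidable P → (ω : Fin n) → Decidable (λ c → P c × c ≢ ω)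
  (P? ∖? ω) c = P? c ×-dec ¬? (c ≟ ω)

  image : (Fin n → Fin m) → Subset m
  image f = f ↾ U?

  module _ {ℓ} {P : Pred (Fin n) ℓ} (P? : Decidable P) (f : Fin n → Fin m) {x : Fin m} where

    ∈↾⁺ : P (cls x) → f (cls x) ≡ x → x ∈ f ↾ P?
    ∈↾⁺ p fx≡x = ∈⟦⟧⁺ (λ x → P? (cls x) ×-dec (f (cls x) ≟ x)) (p , fx≡x)

    ∈↾⁻ : x ∈ f ↾ P? → P (cls x) × f (cls x) ≡ x
    ∈↾⁻ = ∈⟦⟧⁻ (λ x → P? (cls x) ×-dec (f (cls x) ≟ x))

  ↾-mono : ∀ {ℓ ℓ′} {P : Pred (Fin n) ℓ} {Q : Pred (Fin n) ℓ′} (P? : Decidable P) (Q? : Decidable Q)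
           {f : Fin n → Fin m} → (∀ {c} → P c → Q c) → f ↾ P? ⊆ f ↾ Q?
  ↾-mono P? Q? {f} P⊆Q x∈ = let p , fx≡x = ∈↾⁻ P? f x∈ in ∈↾⁺ Q? f (P⊆Q p) fx≡x

  module _ {ℓ} {P : Pred (Fin n) ℓ} (P? : Decidable P) where

    section∈↾ : {f : Fin n → Fin m} → IsSection f → ∀ {c} → P c → f c ∈ f ↾ P?
    section∈↾ {f} f-sec {c} p = ∈↾⁺ P? f (subst P (sym (f-sec c)) p) (cong f (f-sec c))

    ↾-subtransversal : (f : Fin n → Fin m) → Subtransversal (f ↾ P?)
    ↾-subtransversal f x y x∈ y∈ x∼y =
      trans (sym (proj₂ (∈↾⁻ P? f x∈))) (trans (cong f x∼y) (proj₂ (∈↾⁻ P? f y∈)))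

    ↾-avoids : {f : Fin n → Fin m} {ω : Fin n} → ¬ P ω → Avoids (f ↾ P?) ω
    ↾-avoids {f} ¬pω z∈ z∈ω = ¬pω (subst P z∈ω (proj₁ (∈↾⁻ P? f z∈)))

    ↾-cong : {f g : Fin n → Fin m} → (∀ {c} → P c → f c ≡ g c) → f ↾ P? ≡ g ↾ P?
    ↾-cong {f} {g} f≡g = ⊆-antisym
      (λ x∈ → let p , fx≡x = ∈↾⁻ P? f x∈ in ∈↾⁺ P? g p (trans (sym (f≡g p)) fx≡x))
      (λ x∈ → let p , gx≡x = ∈↾⁻ P? g x∈ in ∈↾⁺ P? f p (trans (f≡g p) gx≡x))

    ↾-split : {f : Fin n → Fin m} → IsSection f → ∀ {ω} → P ω → f ↾ P? ≡ f ↾ (P? ∖? ω) ∪ ⁅ f ω ⁆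
    ↾-split {f} f-sec {ω} pω = ⊆-antisym ⊆split split⊆
      where
      ⊆split : f ↾ P? ⊆ f ↾ (P? ∖? ω) ∪ ⁅ f ω ⁆
      ⊆split {x} x∈ with ∈↾⁻ P? f x∈ | cls x ≟ ω
      ... | _ , fx≡x | yes x∈ω = subst (_∈ _ ∪ ⁅ f ω ⁆) (trans (cong f (sym x∈ω)) fx≡x) (x∈p∪⁅x⁆ (f ω))
      ... | p , fx≡x | no  x∉ω = p⊆p∪q ⁅ f ω ⁆ (∈↾⁺ (P? ∖? ω) f (p , x∉ω) fx≡x)
      split⊆ : f ↾ (P? ∖? ω) ∪ ⁅ f ω ⁆ ⊆ f ↾ P?
      split⊆ x∈ with x∈p∪⁅y⁆⁻ x∈
      ... | inj₁ x∈′ = ↾-mono (P? ∖? ω) P? {f} proj₁ x∈′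
      ... | inj₂ refl = section∈↾ f-sec pω

  ∈image⁺ : (f : Fin n → Fin m) {x : Fin m} → f (cls x) ≡ x → x ∈ image f
  ∈image⁺ f = ∈↾⁺ U? f tt

  ∈image⁻ : (f : Fin n → Fin m) {x : Fin m} → x ∈ image f → f (cls x) ≡ x
  ∈image⁻ f = proj₂ ∘ ∈↾⁻ U? f

  ∈image-agree : {f g : Fin n → Fin m} {x : Fin m} → f (cls x) ≡ g (cls x) → x ∈ image f → x ∈ image g
  ∈image-agree {f} {g} fx≡gx x∈ = ∈image⁺ g (trans (sym fx≡gx) (∈image⁻ f x∈))

  image-cong : {f g : Fin n → Fin m} → (∀ c → f c ≡ g c) → image f ≡ image g
  image-cong f≗g = ↾-cong U? (λ {c} _ → f≗g c)

  image-injective : {f g : Fin n → Fin m} → IsSection f → image f ≡ image g → ∀ c → f c ≡ g c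
  image-injective {f} {g} f-sec image≡ c =
    sym (trans (cong g (sym (f-sec c))) (∈image⁻ g (subst (f c ∈_) image≡ (section∈↾ U? f-sec tt))))

  image-transversal : {f : Fin n → Fin m} → IsSection f → IsTransversal cls (image f)
  image-transversal {f} f-sec = ↾-subtransversal U? f , λ ω → f ω , section∈↾ U? f-sec tt , f-sec ω

  Subtransversal-⊆ : {S C : Subset m} → Subtransversal S → C ⊆ S → Subtransversal C
  Subtransversal-⊆ S-sub C⊆S x y x∈ y∈ = S-sub x y (C⊆S x∈) (C⊆S y∈)

  ∪⁅⁆-subtransversal : {S : Subset m} {ω : Fin n} {b : Fin m} →
                       Subtransversal S → Avoids S ω → cls b ≡ ω → Subtransversal (S ∪ ⁅ b ⁆)
  ∪⁅⁆-subtransversal S-sub S-avoids b∈ω x y x∈ y∈ x∼y with x∈p∪⁅y⁆⁻ x∈ | x∈p∪⁅y⁆⁻ y∈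
  ... | inj₁ x∈S  | inj₁ y∈S  = S-sub x y x∈S y∈S x∼y
  ... | inj₁ x∈S  | inj₂ refl = ⊥-elim (S-avoids x∈S (trans x∼y b∈ω))
  ... | inj₂ refl | inj₁ y∈S  = ⊥-elim (S-avoids y∈S (trans (sym x∼y) b∈ω))
  ... | inj₂ refl | inj₂ refl = refl

  extend-to-section : {S : Subset m} → Subtransversal S → ∃ λ f → IsSection f × S ⊆ image f
  extend-to-section {S} S-sub =
    proj₁ ∘ pick , proj₂ ∘ pick , λ {x} x∈S → ∈image⁺ (proj₁ ∘ pick) (picks x∈S (meets? (cls x)))
    where
    Meets : Fin n → Set
    Meets c = ∃ λ x → x ∈ S × cls x ≡ c
    meets? : ∀ c → Dec (Meets c)
    meets? c = any? (λ x → (x ∈? S) ×-dec (cls x ≟ c))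
    choose : ∀ c → Dec (Meets c) → ∃ λ x → cls x ≡ c
    choose c (yes (x , _ , x∈c)) = x , x∈c
    choose c (no _)              = cls-surj c
    pick : ∀ c → ∃ λ x → cls x ≡ c
    pick c = choose c (meets? c)
    picks : ∀ {x} → x ∈ S → (d : Dec (Meets (cls x))) → proj₁ (choose (cls x) d) ≡ x
    picks x∈S (yes (y , y∈S , y∼x)) = S-sub _ _ y∈S x∈S y∼x
    picks x∈S (no ¬meets)           = ⊥-elim (¬meets (_ , x∈S , refl))

  transversal⇒image : {T : Subset m} → IsTransversal cls T → ∃ λ f → IsSection f × T ≡ image f
  transversal⇒image {T} (T-sub , T-meets) with extend-to-section T-sub
  ... | f , f-sec , T⊆ = f , f-sec , ⊆-antisym T⊆ ⊆T
    where
    ⊆T : image f ⊆ T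
    ⊆T {x} x∈ with T-meets (cls x)
    ... | t , t∈T , t∼x =
      subst (_∈ T) (trans (sym (∈image⁻ f (T⊆ t∈T))) (trans (cong f t∼x) (∈image⁻ f x∈))) t∈T

  r≤∣S∣ : {S : Subset m} → Subtransversal S → r S ≤ ∣ S ∣
  r≤∣S∣ {S} S-sub with extend-to-section S-sub
  ... | f , f-sec , S⊆ = proj₁ (R1 (image f) (image-transversal f-sec)) S S⊆

  ¬Indep⇒Dep : {S : Subset m} → Subtransversal S → ¬ Indep S → Dep S
  ¬Indep⇒Dep S-sub = ≤∧≢⇒< (r≤∣S∣ S-sub)

  -- Submodularity, inside a transversal containing S, applied to C and S ─ C.
  Indep-⊆ : {S C : Subset m} → Subtransversal S → C ⊆ S → Indep S → Indep C
  Indep-⊆ {S} {C} S-sub C⊆S S-indep with extend-to-section S-sub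
  ... | f , f-sec , S⊆ =
    ≤-antisym (r≤∣S∣ (Subtransversal-⊆ S-sub C⊆S)) (+-cancelʳ-≤ ∣ D ∣ ∣ C ∣ (r C) (begin
      ∣ C ∣ + ∣ D ∣          ≡⟨ sym (∣p∪[q─p]∣≡∣p∣+∣q─p∣ C S) ⟩
      ∣ C ∪ D ∣              ≡⟨ cong ∣_∣ C∪D≡S ⟩
      ∣ S ∣                  ≡⟨ sym S-indep ⟩
      r S                    ≤⟨ m≤m+n (r S) (r (C ∩ D)) ⟩
      r S + r (C ∩ D)        ≡⟨ cong (λ X → r X + r (C ∩ D)) (sym C∪D≡S) ⟩
      r (C ∪ D) + r (C ∩ D)  ≤⟨ submodular C D (S⊆ ∘ C⊆S) (S⊆ ∘ p─q⊆p S C) ⟩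
      r C + r D              ≤⟨ +-monoʳ-≤ (r C) (r≤∣S∣ (Subtransversal-⊆ S-sub (p─q⊆p S C))) ⟩
      r C + ∣ D ∣            ∎))
    where
    open ≤-Reasoning
    submodular = proj₂ (proj₂ (R1 (image f) (image-transversal f-sec)))
    D : Subset m
    D = S ─ C
    C∪D≡S : C ∪ D ≡ S
    C∪D≡S = p⊆q⇒p∪[q─p]≡q C⊆S

  Dep-⊇ : {S C : Subset m} → Subtransversal S → C ⊆ S → Dep C → Dep S
  Dep-⊇ S-sub C⊆S C-dep = ¬Indep⇒Dep S-sub (<⇒≢ C-dep ∘ Indep-⊆ S-sub C⊆S)

  Indep-swap : {S : Subset m} {ω : Fin n} {a b : Fin m} → Subtransversal S → Avoids S ω →
               cls a ≡ ω → cls b ≡ ω → a ≢ b → Indep S → Dep (S ∪ ⁅ b ⁆) → Indep (S ∪ ⁅ a ⁆)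
  Indep-swap {S} {ω} {a} {b} S-sub S-avoids a∈ω b∈ω a≢b S-indep Sb-dep =
    ≤-antisym (r≤∣S∣ (∪⁅⁆-subtransversal S-sub S-avoids a∈ω))
              (subst (_≤ r (S ∪ ⁅ a ⁆)) (sym ∣S+a∣) (2*m+1≤n+o⇒o≤m⇒m<n R2-at-S r[S+b]≤∣S∣))
    where
    ∣S+a∣ : ∣ S ∪ ⁅ a ⁆ ∣ ≡ suc ∣ S ∣
    ∣S+a∣ = x∉p⇒∣p∪⁅x⁆∣≡1+∣p∣ S (λ a∈S → S-avoids a∈S a∈ω)
    r[S+b]≤∣S∣ : r (S ∪ ⁅ b ⁆) ≤ ∣ S ∣
    r[S+b]≤∣S∣ = ≤-pred (subst (r (S ∪ ⁅ b ⁆) <_) (x∉p⇒∣p∪⁅x⁆∣≡1+∣p∣ S (λ b∈S → S-avoids b∈S b∈ω)) Sb-dep)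
    R2-at-S : 2 * ∣ S ∣ + 1 ≤ r (S ∪ ⁅ a ⁆) + r (S ∪ ⁅ b ⁆)
    R2-at-S = subst (λ k → 2 * k + 1 ≤ r (S ∪ ⁅ a ⁆) + r (S ∪ ⁅ b ⁆)) S-indep
                (R2 S a b S-sub a≢b (trans a∈ω (sym b∈ω)) (λ z z∈S z∼a → S-avoids z∈S (trans z∼a a∈ω)))

  Dep-transfer : {S : Subset m} {ω : Fin n} {a a′ b : Fin m} → Subtransversal S → Avoids S ω →
                 cls a ≡ ω → cls a′ ≡ ω → cls b ≡ ω → a ≢ b →
                 Dep (S ∪ ⁅ b ⁆) → Dep (S ∪ ⁅ a ⁆) → Dep (S ∪ ⁅ a′ ⁆)
  Dep-transfer {S} S-sub S-avoids a∈ω a′∈ω b∈ω a≢b Sb-dep Sa-dep =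
    ¬Indep⇒Dep Sa′-sub λ Sa′-indep →
      <⇒≢ Sa-dep (Indep-swap S-sub S-avoids a∈ω b∈ω a≢b (Indep-⊆ Sa′-sub (p⊆p∪q _) Sa′-indep) Sb-dep)
    where
    Sa′-sub = ∪⁅⁆-subtransversal S-sub S-avoids a′∈ω

  Dep⇒∃circuit⊆ : {S : Subset m} → Subtransversal S → Dep S → ∃ λ C → C ⊆ S × IsCircuit Z C
  Dep⇒∃circuit⊆ {S} = go (<-wellFounded ∣ S ∣)
    where
    go : ∀ {S} → Acc _<_ ∣ S ∣ → Subtransversal S → Dep S → ∃ λ C → C ⊆ S × IsCircuit Z C
    go {S} (acc smaller) S-sub S-dep with any? (λ x → (x ∈? S) ×-dec (r (S - x) <? ∣ S - x ∣))
    ... | yes (x , x∈S , S-x-dep) =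
      let C , C⊆ , C-circuit = go (smaller (x∈p⇒∣p-x∣<∣p∣ x∈S)) (Subtransversal-⊆ S-sub (p─q⊆p S ⁅ x ⁆)) S-x-dep
      in C , p─q⊆p S ⁅ x ⁆ ∘ C⊆ , C-circuit
    ... | no ¬removable = S , id , (S-sub , S-dep) , minimal
      where
      minimal : ∀ C → C ⊂ S → ¬ IsDependent Z C
      minimal C (C⊆S , x , x∈S , x∉C) (_ , C-dep) =
        ¬removable (x , x∈S , Dep-⊇ (Subtransversal-⊆ S-sub (p─q⊆p S ⁅ x ⁆)) C⊆S-x C-dep)
        where
        C⊆S-x : C ⊆ S - x
        C⊆S-x z∈C = x∈p∧x≢y⇒x∈p-y (C⊆S z∈C) λ { refl → x∉C z∈C }

  image-basis : {f : Fin n → Fin m} → IsSection f → Indep (image f) → IsBasis Z (image f)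
  image-basis {f} f-sec f-indep = (↾-subtransversal U? f , f-indep) , maximal
    where
    maximal : ∀ S → image f ⊂ S → ¬ IsIndependent Z S
    maximal S (image⊆S , x , x∈S , x∉image) (S-sub , _) =
      x∉image (∈image⁺ f (S-sub _ _ (image⊆S (section∈↾ U? f-sec tt)) x∈S (f-sec (cls x))))

  basis⇒transversal : NonDegenerate Z → {B : Subset m} → IsBasis Z B → IsTransversal cls B
  basis⇒transversal nd {B} ((B-sub , B-indep) , B-maximal) = B-sub , meets
    where
    meets : ∀ ω → ∃ λ x → x ∈ B × cls x ≡ ω
    meets ω with any? (λ x → (x ∈? B) ×-dec (cls x ≟ ω)) | nd ω
    ... | yes B∩ω  | _ = B∩ω
    ... | no B∩ω=∅ | x , y , x≢y , x∈ω , y∈ω =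
      ⊥-elim (¬indep x∈ω (Indep-swap B-sub avoids x∈ω y∈ω x≢y B-indep (¬Indep⇒Dep (B+-sub y∈ω) (¬indep y∈ω))))
      where
      avoids : Avoids B ω
      avoids z∈B z∈ω = B∩ω=∅ (_ , z∈B , z∈ω)
      B+-sub : ∀ {z} → cls z ≡ ω → Subtransversal (B ∪ ⁅ z ⁆)
      B+-sub = ∪⁅⁆-subtransversal B-sub avoids
      ¬indep : ∀ {z} → cls z ≡ ω → ¬ Indep (B ∪ ⁅ z ⁆)
      ¬indep {z} z∈ω indep =
        B-maximal (B ∪ ⁅ z ⁆) (p⊆p∪q ⁅ z ⁆ , z , x∈p∪⁅x⁆ z , λ z∈B → avoids z∈B z∈ω) (B+-sub z∈ω , indep)

  _[_≔_] : (Fin n → Fin m) → Fin n → Fin m → Fin n → Fin m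
  f [ ω ≔ a ] = updateAt f ω (λ _ → a)

  [≔]-section : {f : Fin n → Fin m} {ω : Fin n} {a : Fin m} → IsSection f → cls a ≡ ω → IsSection (f [ ω ≔ a ])
  [≔]-section {f} {ω} f-sec a∈ω c with c ≟ ω
  ... | yes refl = trans (cong cls (updateAt-updates c f)) a∈ω
  ... | no  c≢ω  = trans (cong cls (updateAt-minimal c ω f c≢ω)) (f-sec c)

  module _ (_≺_ : Rel (Fin n) 0ℓ) (≺-isSTO : IsStrictTotalOrder _≡_ _≺_) where
    open IsStrictTotalOrder ≺-isSTO
      using (isStrictPartialOrder) renaming (_<?_ to _≺?_; irrefl to ≺-irrefl; trans to ≺-trans)

    ≺-irr : ∀ {c} → ¬ c ≺ c
    ≺-irr = ≺-irrefl refl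

    above : (Fin n → Fin m) → Fin n → Subset m
    above f ω = f ↾ (ω ≺?_)

    -- For ω active with respect to the basis B = image f, the y with SpannedAbove f ω y is the paper's B̲_ω.
    SpannedAbove : (Fin n → Fin m) → Fin n → Fin m → Set
    SpannedAbove f ω y = cls y ≡ ω × Dep (above f ω ∪ ⁅ y ⁆)

    SpannedAbove? : (f : Fin n → Fin m) (ω : Fin n) → Decidable (SpannedAbove f ω)
    SpannedAbove? f ω y = (cls y ≟ ω) ×-dec (r (above f ω ∪ ⁅ y ⁆) <? ∣ above f ω ∪ ⁅ y ⁆ ∣)

    above⊆image : (f : Fin n → Fin m) (ω : Fin n) → above f ω ⊆ image f
    above⊆image f ω = ↾-mono (ω ≺?_) U? {f} (λ _ → tt)

    above-avoids : (f : Fin n → Fin m) (ω : Fin n) → Avoids (above f ω) ω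
    above-avoids f ω = ↾-avoids (ω ≺?_) {f} ≺-irr

    above∪⁅⁆-subtransversal : (f : Fin n → Fin m) (ω : Fin n) {y : Fin m} → cls y ≡ ω →
                              Subtransversal (above f ω ∪ ⁅ y ⁆)
    above∪⁅⁆-subtransversal f ω = ∪⁅⁆-subtransversal (↾-subtransversal (ω ≺?_) f) (above-avoids f ω)

    SpannedAbove-cong : {f g : Fin n → Fin m} {ω : Fin n} → (∀ {c} → ω ≺ c → f c ≡ g c) →
                        ∀ y → SpannedAbove f ω y ⇔ SpannedAbove g ω y
    SpannedAbove-cong {ω = ω} f≡g y = mk⇔
      (λ (y∈ω , dep) → y∈ω , subst (λ A → Dep (A ∪ ⁅ y ⁆)) above≡ dep)
      (λ (y∈ω , dep) → y∈ω , subst (λ A → Dep (A ∪ ⁅ y ⁆)) (sym above≡) dep)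
      where
      above≡ = ↾-cong (ω ≺?_) f≡g

    module _ {f : Fin n → Fin m} (f-sec : IsSection f) (f-indep : Indep (image f)) where

      ¬SpannedAbove-self : ∀ ω → ¬ SpannedAbove f ω (f ω)
      ¬SpannedAbove-self ω (_ , dep) = <⇒≢ dep (Indep-⊆ (↾-subtransversal U? f) ⊆image f-indep)
        where
        ⊆image : above f ω ∪ ⁅ f ω ⁆ ⊆ image f
        ⊆image x∈ with x∈p∪⁅y⁆⁻ x∈
        ... | inj₁ x∈above = above⊆image f ω x∈above
        ... | inj₂ refl    = section∈↾ U? f-sec tt

      SpannedAbove-unique : ∀ {ω y y′} → SpannedAbove f ω y → SpannedAbove f ω y′ → y ≡ y′
      SpannedAbove-unique {ω} {y} {y′} (y∈ω , y-dep) (y′∈ω , y′-dep) with y ≟ y′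
      ... | yes y≡y′ = y≡y′
      ... | no  y≢y′ = ⊥-elim (<⇒≢ y-dep
            (Indep-swap (↾-subtransversal (ω ≺?_) f) (above-avoids f ω) y∈ω y′∈ω y≢y′
                        (Indep-⊆ (↾-subtransversal U? f) (above⊆image f ω) f-indep) y′-dep))

      active⇔∃SpannedAbove : ∀ ω → Active Z _≺_ (image f) ω ⇔ ∃ (SpannedAbove f ω)
      active⇔∃SpannedAbove ω = mk⇔ to from
        where
        to : Active Z _≺_ (image f) ω → ∃ (SpannedAbove f ω)
        to (C , ((C-sub , C-dep) , _) , C⊆ , (y , y∈C , y∈ω) , C≽ω) =
          y , y∈ω , Dep-⊇ (above∪⁅⁆-subtransversal f ω y∈ω) C⊆above+y C-dep
          where
          C⊆above+y : C ⊆ above f ω ∪ ⁅ y ⁆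
          C⊆above+y {z} z∈C with C≽ω z z∈C | C⊆ z z∈C
          ... | inj₁ z∈ω | _ =
            subst (_∈ above f ω ∪ ⁅ y ⁆) (C-sub y z y∈C z∈C (trans y∈ω (sym z∈ω))) (x∈p∪⁅x⁆ y)
          ... | inj₂ ω≺z | inj₁ z∈image = p⊆p∪q ⁅ y ⁆ (∈↾⁺ (ω ≺?_) f ω≺z (∈image⁻ f z∈image))
          ... | inj₂ ω≺z | inj₂ z∈ω     = ⊥-elim (≺-irr (subst (ω ≺_) z∈ω ω≺z))
        from : ∃ (SpannedAbove f ω) → Active Z _≺_ (image f) ω
        from (y , y∈ω , y-dep) with Dep⇒∃circuit⊆ (above∪⁅⁆-subtransversal f ω y∈ω) y-dep
        ... | C , C⊆ , C-circuit@((_ , C-dep) , _) = C , C-circuit , C⊆image∪ω , (y , y∈C , y∈ω) , C≽ω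
          where
          C⊆image∪ω : ∀ x → x ∈ C → x ∈ image f ⊎ cls x ≡ ω
          C⊆image∪ω x x∈C with x∈p∪⁅y⁆⁻ (C⊆ x∈C)
          ... | inj₁ x∈above = inj₁ (above⊆image f ω x∈above)
          ... | inj₂ refl    = inj₂ y∈ω
          C≽ω : ∀ x → x ∈ C → cls x ≡ ω ⊎ ω ≺ cls x
          C≽ω x x∈C with x∈p∪⁅y⁆⁻ (C⊆ x∈C)
          ... | inj₁ x∈above = inj₂ (proj₁ (∈↾⁻ (ω ≺?_) f x∈above))
          ... | inj₂ refl    = inj₁ y∈ω
          C⊆image : y ∉ C → C ⊆ image f
          C⊆image y∉C x∈C with x∈p∪⁅y⁆⁻ (C⊆ x∈C)
          ... | inj₁ x∈above = above⊆image f ω x∈above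
          ... | inj₂ refl    = ⊥-elim (y∉C x∈C)
          y∈C : y ∈ C
          y∈C = decidable-stable (y ∈? C)
                  (λ y∉C → <⇒≢ C-dep (Indep-⊆ (↾-subtransversal U? f) (C⊆image y∉C) f-indep))

    module _ {f : Fin n → Fin m} {ω : Fin n} {a b : Fin m} (f-sec : IsSection f) (f-indep : Indep (image f))
             (b-spanned : SpannedAbove f ω b) (a∈ω : cls a ≡ ω) (a≢b : a ≢ b) where

      private
        b∈ω : cls b ≡ ω
        b∈ω = proj₁ b-spanned

        f[ω≔a]≡f : ∀ {c} → c ≢ ω → (f [ ω ≔ a ]) c ≡ f c
        f[ω≔a]≡f c≢ω = updateAt-minimal _ ω f c≢ω

        ⊇above⇒Dep : {S : Subset m} → Subtransversal S → Avoids S ω → above f ω ⊆ S → Dep (S ∪ ⁅ b ⁆)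
        ⊇above⇒Dep S-sub S-avoids above⊆S =
          Dep-⊇ (∪⁅⁆-subtransversal S-sub S-avoids b∈ω) (p⊆q⇒p∪⁅x⁆⊆q∪⁅x⁆ above⊆S) (proj₂ b-spanned)

      exchange-indep : Indep (image (f [ ω ≔ a ]))
      exchange-indep =
        subst Indep (sym image≡)
              (Indep-swap R-sub R-avoids a∈ω b∈ω a≢b R-indep (⊇above⇒Dep R-sub R-avoids above⊆R))
        where
        R : Subset m
        R = f ↾ (U? ∖? ω)
        R-sub : Subtransversal R
        R-sub = ↾-subtransversal (U? ∖? ω) f
        R-avoids : Avoids R ω
        R-avoids = ↾-avoids (U? ∖? ω) {f} (λ (_ , ω≢ω) → ω≢ω refl)
        R-indep : Indep R
        R-indep = Indep-⊆ (↾-subtransversal U? f) (↾-mono (U? ∖? ω) U? {f} proj₁) f-indep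
        above⊆R : above f ω ⊆ R
        above⊆R = ↾-mono (ω ≺?_) (U? ∖? ω) {f} (λ ω≺c → tt , λ { refl → ≺-irr ω≺c })
        image≡ : image (f [ ω ≔ a ]) ≡ R ∪ ⁅ a ⁆
        image≡ = trans (↾-split U? ([≔]-section f-sec a∈ω) tt)
                       (cong₂ (λ A x → A ∪ ⁅ x ⁆) (↾-cong (U? ∖? ω) (f[ω≔a]≡f ∘ proj₂)) (updateAt-updates ω f))

      -- Only classes c ≺ ω see the change; there b, spanned above ω, lets dependence pass between
      -- f ω and a (Dep-transfer).
      exchange-SpannedAbove : ∀ c y → SpannedAbove f c y ⇔ SpannedAbove (f [ ω ≔ a ]) c y
      exchange-SpannedAbove c y with c ≺? ω
      ... | no ¬c≺ω = SpannedAbove-cong (λ c≺d → sym (f[ω≔a]≡f (λ { refl → ¬c≺ω c≺d }))) y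
      ... | yes c≺ω = mk⇔ (λ (y∈c , dep) → y∈c , forward y∈c dep) (λ (y∈c , dep) → y∈c , backward y∈c dep)
        where
        M : Subset m
        M = f ↾ ((c ≺?_) ∖? ω) ∪ ⁅ y ⁆
        above≡ : {g : Fin n → Fin m} {x : Fin m} → IsSection g → (∀ {d} → c ≺ d × d ≢ ω → g d ≡ f d) →
                 g ω ≡ x → above g c ∪ ⁅ y ⁆ ≡ M ∪ ⁅ x ⁆
        above≡ {g} {x} g-sec g≡f gω≡x = begin
          above g c ∪ ⁅ y ⁆                       ≡⟨ cong (_∪ ⁅ y ⁆) (↾-split (c ≺?_) g-sec c≺ω) ⟩
          (g ↾ ((c ≺?_) ∖? ω) ∪ ⁅ g ω ⁆) ∪ ⁅ y ⁆  ≡⟨ [p∪q]∪r≡[p∪r]∪q _ ⁅ g ω ⁆ ⁅ y ⁆ ⟩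
          (g ↾ ((c ≺?_) ∖? ω) ∪ ⁅ y ⁆) ∪ ⁅ g ω ⁆  ≡⟨ cong₂ (λ A z → (A ∪ ⁅ y ⁆) ∪ ⁅ z ⁆)
                                                          (↾-cong ((c ≺?_) ∖? ω) g≡f) gω≡x ⟩
          M ∪ ⁅ x ⁆                               ∎
          where open ≡-Reasoning
        above≡f : above f c ∪ ⁅ y ⁆ ≡ M ∪ ⁅ f ω ⁆
        above≡f = above≡ f-sec (λ _ → refl) refl
        above≡f[ω≔a] : above (f [ ω ≔ a ]) c ∪ ⁅ y ⁆ ≡ M ∪ ⁅ a ⁆
        above≡f[ω≔a] = above≡ ([≔]-section f-sec a∈ω) (f[ω≔a]≡f ∘ proj₂) (updateAt-updates ω f)
        fω≢b : f ω ≢ b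
        fω≢b fω≡b = ¬SpannedAbove-self f-sec f-indep ω (subst (SpannedAbove f ω) (sym fω≡b) b-spanned)
        module _ (y∈c : cls y ≡ c) where
          M-sub : Subtransversal M
          M-sub = ∪⁅⁆-subtransversal (↾-subtransversal ((c ≺?_) ∖? ω) f)
                                     (↾-avoids ((c ≺?_) ∖? ω) {f} (λ (c≺c , _) → ≺-irr c≺c)) y∈c
          M-avoids : Avoids M ω
          M-avoids x∈ with x∈p∪⁅y⁆⁻ x∈
          ... | inj₁ x∈M  = ↾-avoids ((c ≺?_) ∖? ω) {f} (λ (_ , ω≢ω) → ω≢ω refl) x∈M
          ... | inj₂ refl = λ y∈ω → ≺-irr (subst (c ≺_) (trans (sym y∈ω) y∈c) c≺ω)
          Mb-dep : Dep (M ∪ ⁅ b ⁆)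
          Mb-dep = ⊇above⇒Dep M-sub M-avoids
            (p⊆p∪q ⁅ y ⁆ ∘ ↾-mono (ω ≺?_) ((c ≺?_) ∖? ω) {f} (λ ω≺d → ≺-trans c≺ω ω≺d , λ { refl → ≺-irr ω≺d }))
          forward : Dep (above f c ∪ ⁅ y ⁆) → Dep (above (f [ ω ≔ a ]) c ∪ ⁅ y ⁆)
          forward dep = subst Dep (sym above≡f[ω≔a])
            (Dep-transfer M-sub M-avoids (f-sec ω) a∈ω b∈ω fω≢b Mb-dep (subst Dep above≡f dep))
          backward : Dep (above (f [ ω ≔ a ]) c ∪ ⁅ y ⁆) → Dep (above f c ∪ ⁅ y ⁆)
          backward dep = subst Dep (sym above≡f)
            (Dep-transfer M-sub M-avoids a∈ω (f-sec ω) b∈ω a≢b Mb-dep (subst Dep above≡f[ω≔a] dep))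

    SameSpans : (Fin n → Fin m) → (Fin n → Fin m) → Set
    SameSpans f g = ∀ c y → SpannedAbove f c y ⇔ SpannedAbove g c y

    ≗⇒SameSpans : {f g : Fin n → Fin m} → (∀ c → f c ≡ g c) → SameSpans f g
    ≗⇒SameSpans f≗g c = SpannedAbove-cong (λ {d} _ → f≗g d)

    SameSpans⇒∃⇔∃ : {f g : Fin n → Fin m} → SameSpans f g → ∀ c → ∃ (SpannedAbove f c) ⇔ ∃ (SpannedAbove g c)
    SameSpans⇒∃⇔∃ f∼g c =
      mk⇔ (λ (y , s) → y , Equivalence.to (f∼g c y) s) (λ (y , s) → y , Equivalence.from (f∼g c y) s)

    -- Induction on D, exchanging f c for g c at its head: each exchange keeps the spanned elements,
    -- hence the hypotheses.
    exchange-all : (D : List (Fin n)) {f g : Fin n → Fin m} → IsSection f → Indep (image f) → IsSection g →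
                   (∀ {c} → f c ≢ g c → c ∈ₗ D) → (∀ {c} → f c ≢ g c → ∃ (SpannedAbove f c)) →
                   (∀ c → ¬ SpannedAbove f c (g c)) → Indep (image g) × SameSpans f g
    exchange-all [] {f} {g} f-sec f-indep g-sec differs∈ _ _ =
      subst Indep (image-cong f≗g) f-indep , ≗⇒SameSpans f≗g
      where
      f≗g : ∀ c → f c ≡ g c
      f≗g c = decidable-stable (f c ≟ g c) (¬Any[] ∘ differs∈)
    exchange-all (c ∷ D) {f} {g} f-sec f-indep g-sec differs∈ differs⇒active ¬spanned =
      let g-indep , f′∼g = exchange-all D f′-sec (proj₁ step) g-sec differs∈′ differs⇒active′ ¬spanned′
      in g-indep , λ d y → f′∼g d y ⇔-∘ proj₂ step d y
      where
      f′ : Fin n → Fin m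
      f′ = f [ c ≔ g c ]
      f′-sec : IsSection f′
      f′-sec = [≔]-section f-sec (g-sec c)
      step : Indep (image f′) × SameSpans f f′
      step with f c ≟ g c
      ... | yes fc≡gc = subst Indep (image-cong f≗f′) f-indep , ≗⇒SameSpans f≗f′
        where
        f≗f′ : ∀ d → f d ≡ f′ d
        f≗f′ d = sym (updateAt-id-local c f (sym fc≡gc) d)
      ... | no fc≢gc with differs⇒active fc≢gc
      ...   | b , b-spanned = exchange-indep f-sec f-indep b-spanned (g-sec c) gc≢b ,
                              exchange-SpannedAbove f-sec f-indep b-spanned (g-sec c) gc≢b
        where
        gc≢b : g c ≢ b
        gc≢b refl = ¬spanned c b-spanned
      still-differs : ∀ {d} → f′ d ≢ g d → d ≢ c × f d ≢ g d
      still-differs {d} f′d≢gd with d ≟ c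
      ... | yes refl = ⊥-elim (f′d≢gd (updateAt-updates c f))
      ... | no  d≢c  = d≢c , f′d≢gd ∘ trans (updateAt-minimal d c f d≢c)
      differs∈′ : ∀ {d} → f′ d ≢ g d → d ∈ₗ D
      differs∈′ f′d≢gd with still-differs f′d≢gd
      ... | d≢c , fd≢gd with differs∈ fd≢gd
      ...   | hereₗ d≡c  = ⊥-elim (d≢c d≡c)
      ...   | thereₗ d∈D = d∈D
      differs⇒active′ : ∀ {d} → f′ d ≢ g d → ∃ (SpannedAbove f′ d)
      differs⇒active′ {d} =
        Equivalence.to (SameSpans⇒∃⇔∃ {f} {f′} (proj₂ step) d) ∘ differs⇒active ∘ proj₂ ∘ still-differs
      ¬spanned′ : ∀ d → ¬ SpannedAbove f′ d (g d)
      ¬spanned′ d = ¬spanned d ∘ Equivalence.from (proj₂ step d (g d))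

    -- Downward induction along ≺: were g ω spanned above ω for f, it would be so for the section h that
    -- agrees with g above ω and with f elsewhere (exchange-all), and h spans above ω exactly like g.
    agreeOnInactive⇒¬SpannedAbove :
      {f g : Fin n → Fin m} → IsSection f → Indep (image f) → IsSection g → Indep (image g) →
      (∀ {c} → ¬ ∃ (SpannedAbove f c) → g c ≡ f c) → ∀ c → ¬ SpannedAbove f c (g c)
    agreeOnInactive⇒¬SpannedAbove {f} {g} f-sec f-indep g-sec g-indep inactive⇒same c =
      go c (spo-noetherian isStrictPartialOrder c)
      where
      go : ∀ ω → Acc (flip _≺_) ω → ¬ SpannedAbove f ω (g ω)
      go ω (acc larger) spanned =
        ¬SpannedAbove-self g-sec g-indep ω
          (Equivalence.to (SpannedAbove-cong h≡g (g ω)) (Equivalence.to (proj₂ f∼h ω (g ω)) spanned))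
        where
        h : Fin n → Fin m
        h d with ω ≺? d
        ... | yes _ = g d
        ... | no  _ = f d
        h≡g : ∀ {d} → ω ≺ d → h d ≡ g d
        h≡g {d} ω≺d with ω ≺? d
        ... | yes _    = refl
        ... | no ¬ω≺d = ⊥-elim (¬ω≺d ω≺d)
        h-sec : IsSection h
        h-sec d with ω ≺? d
        ... | yes _ = g-sec d
        ... | no  _ = f-sec d
        differs⇒active : ∀ {d} → f d ≢ h d → ∃ (SpannedAbove f d)
        differs⇒active {d} fd≢hd with ω ≺? d
        ... | yes _ = decidable-stable (any? (SpannedAbove? f d))
                                       (λ inactive → fd≢hd (sym (inactive⇒same inactive)))
        ... | no  _ = ⊥-elim (fd≢hd refl)
        ¬spanned : ∀ d → ¬ SpannedAbove f d (h d)
        ¬spanned d with ω ≺? d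
        ... | yes ω≺d = go d (larger ω≺d)
        ... | no  _   = ¬SpannedAbove-self f-sec f-indep d
        f∼h : Indep (image h) × SameSpans f h
        f∼h = exchange-all (allFin n) f-sec f-indep h-sec (λ {d} _ → ∈-allFin d) differs⇒active ¬spanned

    module _ (nd : NonDegenerate Z) {f : Fin n → Fin m} (f-sec : IsSection f) (f-indep : Indep (image f)) where

      ∃SpannedAbove? : Decidable (λ ω → ∃ (SpannedAbove f ω))
      ∃SpannedAbove? ω = any? (SpannedAbove? f ω)

      Allowed : Fin n → Fin m → Set
      Allowed c y = ¬ SpannedAbove f c y × (¬ ∃ (SpannedAbove f c) → y ≡ f c)

      Allowed? : ∀ c → Decidable (Allowed c)
      Allowed? c y = ¬? (SpannedAbove? f c y) ×-dec (¬? (∃SpannedAbove? c) →-dec (y ≟ f c))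

      basis∼⇔Allowed : {g : Fin n → Fin m} → IsSection g →
                       (IsBasis Z (image g) × _∼_ Z _≺_ (image f) (image g)) ⇔ (∀ c → Allowed c (g c))
      basis∼⇔Allowed {g} g-sec = mk⇔ to from
        where
        to : IsBasis Z (image g) × _∼_ Z _≺_ (image f) (image g) → ∀ c → Allowed c (g c)
        to (((_ , g-indep) , _) , _ , same) c =
          agreeOnInactive⇒¬SpannedAbove f-sec f-indep g-sec g-indep inactive⇒same c , inactive⇒same
          where
          inactive⇒same : ∀ {d} → ¬ ∃ (SpannedAbove f d) → g d ≡ f d
          inactive⇒same {d} inactive =
            trans (cong g (sym (f-sec d)))
                  (∈image⁻ g (Equivalence.to (same d inactive′ (f d) (f-sec d)) (section∈↾ U? f-sec tt)))
            where
            inactive′ = inactive ∘ Equivalence.to (active⇔∃SpannedAbove f-sec f-indep d)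
        from : (∀ c → Allowed c (g c)) → IsBasis Z (image g) × _∼_ Z _≺_ (image f) (image g)
        from g-allowed = image-basis g-sec g-indep , active⇔active , same
          where
          differs⇒active : ∀ {c} → f c ≢ g c → ∃ (SpannedAbove f c)
          differs⇒active {c} fc≢gc =
            decidable-stable (∃SpannedAbove? c) (λ inactive → fc≢gc (sym (proj₂ (g-allowed c) inactive)))
          f∼g : Indep (image g) × SameSpans f g
          f∼g = exchange-all (allFin n) f-sec f-indep g-sec (λ {c} _ → ∈-allFin c) differs⇒active
                             (proj₁ ∘ g-allowed)
          g-indep = proj₁ f∼g
          active⇔active : ∀ c → Active Z _≺_ (image f) c ⇔ Active Z _≺_ (image g) c
          active⇔active c = ⇔-sym (active⇔∃SpannedAbove g-sec g-indep c)
                            ⇔-∘ (SameSpans⇒∃⇔∃ {f} {g} (proj₂ f∼g) c ⇔-∘ active⇔∃SpannedAbove f-sec f-indep c)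
          same : ∀ c → Inactive Z _≺_ (image f) c → SameAt Z _≺_ (image f) (image g) c
          same c inactive x x∈c = mk⇔ (∈image-agree {f} {g} (sym gx≡fx)) (∈image-agree {g} {f} gx≡fx)
            where
            gx≡fx : g (cls x) ≡ f (cls x)
            gx≡fx = subst (λ d → g d ≡ f d) (sym x∈c)
                      (proj₂ (g-allowed c) (inactive ∘ Equivalence.from (active⇔∃SpannedAbove f-sec f-indep c)))

      members : Fin n → List (Fin m)
      members ω = filter (λ x → cls x ≟ ω) (allFin m)

      members-unique : ∀ ω → Unique (members ω)
      members-unique ω = Unique.filter⁺ (λ x → cls x ≟ ω) (Unique.allFin⁺ m)

      ∈members : ∀ {x ω} → cls x ≡ ω → x ∈ₗ members ω
      ∈members {x} {ω} = ∈-filter⁺ (λ x → cls x ≟ ω) (∈-allFin x)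

      allowed : Fin n → List (Fin m)
      allowed c = filter (Allowed? c) (members c)

      ∈allowed⁺ : ∀ {c y} → cls y ≡ c → Allowed c y → y ∈ₗ allowed c
      ∈allowed⁺ {c} y∈c = ∈-filter⁺ (Allowed? c) (∈members y∈c)

      ∈allowed⁻ : ∀ {c y} → y ∈ₗ allowed c → cls y ≡ c × Allowed c y
      ∈allowed⁻ {c} y∈ =
        let y∈members , y-allowed = ∈-filter⁻ (Allowed? c) y∈
        in proj₂ (∈-filter⁻ (λ x → cls x ≟ c) {xs = allFin m} y∈members) , y-allowed

      length-allowed-active : ∀ {c} → ∃ (SpannedAbove f c) → length (allowed c) ≡ classSize cls c ∸ 1
      length-allowed-active {c} (b , b-spanned) =
        trans (cong length (filter-≐ (Allowed? c) (λ y → ¬? (y ≟ b)) allowed≐≢b (members c)))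
              (length-filter-≢ _≟_ (members-unique c) (∈members (proj₁ b-spanned)))
        where
        allowed≐≢b : Allowed c ≐ (_≢ b)
        allowed≐≢b = (λ (¬spanned , _) y≡b → ¬spanned (subst (SpannedAbove f c) (sym y≡b) b-spanned))
                   , (λ y≢b → (λ spanned → y≢b (SpannedAbove-unique f-sec f-indep spanned b-spanned))
                            , (λ inactive → ⊥-elim (inactive (b , b-spanned))))

      length-allowed-inactive : ∀ {c} → ¬ ∃ (SpannedAbove f c) → length (allowed c) ≡ 1
      length-allowed-inactive {c} inactive =
        trans (cong length (filter-≐ (Allowed? c) (_≟ f c) allowed≐≡fc (members c)))
              (length-filter-≡ _≟_ (members-unique c) (∈members (f-sec c)))
        where
        allowed≐≡fc : Allowed c ≐ (_≡ f c)
        allowed≐≡fc = (λ (_ , same) → same inactive)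
                    , λ { refl → ¬SpannedAbove-self f-sec f-indep c , λ _ → refl }

      actives : List (Fin n)
      actives = filter ∃SpannedAbove? (allFin n)

      actives-enumerate : Enumerates Z _≺_ actives (Active Z _≺_ (image f))
      actives-enumerate = Unique.filter⁺ ∃SpannedAbove? (Unique.allFin⁺ n) , λ ω → mk⇔
        (Equivalence.from (active⇔∃SpannedAbove f-sec f-indep ω) ∘ proj₂
                                                                  ∘ ∈-filter⁻ ∃SpannedAbove? {xs = allFin n})
        (∈-filter⁺ ∃SpannedAbove? (∈-allFin ω) ∘ Equivalence.to (active⇔∃SpannedAbove f-sec f-indep ω))

      equivalentBases : List (Subset m)
      equivalentBases = map (image ∘ lookup) (choices allowed)

      lookup-section : ∀ {v} → v ∈ₗ choices allowed → IsSection (lookup v)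
      lookup-section v∈ c = proj₁ (∈allowed⁻ (∈-choices⁻ allowed _ v∈ c))

      equivalentBases-enumerate :
        Enumerates Z _≺_ equivalentBases (λ B′ → IsBasis Z B′ × _∼_ Z _≺_ (image f) B′)
      equivalentBases-enumerate =
        unique-map⁺ image-inj (choices-unique allowed (λ c → Unique.filter⁺ (Allowed? c) (members-unique c))) ,
        λ B′ → mk⇔ sound complete
        where
        image-inj : ∀ {v w} → v ∈ₗ choices allowed → w ∈ₗ choices allowed →
                    image (lookup v) ≡ image (lookup w) → v ≡ w
        image-inj {v} {w} v∈ _ image≡ = begin
          v                    ≡⟨ sym (tabulate∘lookup v) ⟩
          tabulate (lookup v)  ≡⟨ tabulate-cong (image-injective (lookup-section v∈) image≡) ⟩
          tabulate (lookup w)  ≡⟨ tabulate∘lookup w ⟩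
          w                    ∎
          where open ≡-Reasoning
        sound : ∀ {B′} → B′ ∈ₗ equivalentBases → IsBasis Z B′ × _∼_ Z _≺_ (image f) B′
        sound B′∈ with ∈-map⁻ (image ∘ lookup) B′∈
        ... | v , v∈ , refl = Equivalence.from (basis∼⇔Allowed (lookup-section v∈))
                                (λ c → proj₂ (∈allowed⁻ (∈-choices⁻ allowed v v∈ c)))
        complete : ∀ {B′} → IsBasis Z B′ × _∼_ Z _≺_ (image f) B′ → B′ ∈ₗ equivalentBases
        complete (B′-basis , f∼B′) with transversal⇒image (basis⇒transversal nd B′-basis)
        ... | g , g-sec , refl = subst (_∈ₗ equivalentBases) (image-cong (lookup∘tabulate g))
                                   (∈-map⁺ (image ∘ lookup) (∈-choices⁺ allowed (tabulate g) tabulate∈))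
          where
          g-allowed : ∀ c → Allowed c (g c)
          g-allowed = Equivalence.to (basis∼⇔Allowed g-sec) (B′-basis , f∼B′)
          tabulate∈ : ∀ c → lookup (tabulate g) c ∈ₗ allowed c
          tabulate∈ c = subst (_∈ₗ allowed c) (sym (lookup∘tabulate g c)) (∈allowed⁺ (g-sec c) (g-allowed c))

      length-equivalentBases : length equivalentBases ≡ product (map (λ ω → classSize cls ω ∸ 1) actives)
      length-equivalentBases = begin
        length (map (image ∘ lookup) (choices allowed))    ≡⟨ length-map (image ∘ lookup) (choices allowed) ⟩
        length (choices allowed)                           ≡⟨ length-choices allowed ⟩
        product (List.tabulate (length ∘ allowed))         ≡⟨ cong product
                                                                (sym (map-tabulate id (length ∘ allowed))) ⟩
        product (map (length ∘ allowed) (allFin n))        ≡⟨ product-map-filter ∃SpannedAbove? _ _ (allFin n)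
                                                                (λ _ → length-allowed-active)
                                                                (λ _ → length-allowed-inactive) ⟩
        product (map (λ ω → classSize cls ω ∸ 1) actives)  ∎
        where open ≡-Reasoning

      classCountFormula : ClassCountFormula Z _≺_ (image f)
      classCountFormula =
        actives , actives-enumerate , equivalentBases , equivalentBases-enumerate , length-equivalentBases

theorem3p18 : {m n : ℕ} (Z : Multimatroid m n) → NonDegenerate Z →
    (_≺_ : Rel (Fin n) 0ℓ) → IsStrictTotalOrder _≡_ _≺_ →
    (B : Subset m) → IsBasis Z B → ClassCountFormula Z _≺_ B
theorem3p18 Z nd _≺_ ≺-isSTO B B-basis with transversal⇒image Z (basis⇒transversal Z nd B-basis)
... | f , f-sec , refl = classCountFormula Z _≺_ ≺-isSTO nd f-sec (proj₂ (proj₁ B-basis))
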